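{- Let $G$ be an NG-graph with ABC-partition $V(G)=A\cup B\cup C$. Then $G-A$ is a split graph with KS-partition $K=B$, $S=C$. Moreover, if $G$ is an NG-1 graph then this KS-partition of $G-A$ is $S$-max, and if $G$ is an NG-2 graph then it is $K$-max.
   Context: Graphs are finite and simple; $\chi,\omega,\alpha$ are chromatic, clique and independence numbers, $\overline{G}$ the complement. $G$ is an NG-graph if $\chi(G)+\chi(\overline{G})=|V(G)|+1$; its ABC-partition is $A=\{v:\deg(v)=\chi(G)-1\}$, $B=\{v:\deg(v)>\chi(G)-1\}$, $C=\{v:\deg(v)<\chi(G)-1\}$. An NG-graph is NG-1 if $G[A]$ is a clique, NG-2 if $G[A]$ is a stable set. A KS-partition of a graph $H$ is a partition $V(H)=K\cup S$ with $K$ a clique and $S$ a stable set; a split graph is one having a KS-partition. A KS-partition is $K$-max if $|K|=\omega(H)$ and $S$-max if $|S|=\alpha(H)$. -}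

module Defs where

open import Data.Nat using (ℕ; suc; _≤_; _<_)
open import Data.Nat.Properties using (_≟_; _<?_)
open import Data.Bool using (Bool; true; false; not; if_then_else_)
open import Data.Fin using (Fin)
import Data.Fin.Properties as FinP
open import Data.Fin.Subset using (Subset; _∈_; _∉_; _⊆_; ∣_∣; _∪_; _∩_; ⊥)
open import Data.Vec using (tabulate)
open import Data.Product using (_×_)
open import Relation.Nullary using (¬_; yes; no)
open import Relation.Nullary.Decidable using (⌊_⌋)
open import Relation.Binary.PropositionalEquality using (_≡_; _≢_; refl; sym)

record Graph (n : ℕ) : Set where
  field
    adj    : Fin n → Fin n → Bool
    symm   : ∀ u v → adj u v ≡ adj v u
    irrefl : ∀ v → adj v v ≡ false
open Graph public

complAdj : ∀ {n} → Graph n → Fin n → Fin n → Bool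
complAdj G u v with u FinP.≟ v
... | yes _ = false
... | no  _ = not (adj G u v)

complement : ∀ {n} → Graph n → Graph n
complement {n} G = record { adj = complAdj G ; symm = s ; irrefl = i }
  where
  s : ∀ u v → complAdj G u v ≡ complAdj G v u
  s u v with u FinP.≟ v | v FinP.≟ u
  ... | yes _  | yes _  = refl
  ... | yes p  | no ¬q  with ¬q (sym p)
  ...   | ()
  s u v | no ¬p | yes q with ¬p (sym q)
  ...   | ()
  s u v | no _  | no _  rewrite symm G u v = refl
  i : ∀ v → complAdj G v v ≡ false
  i v with v FinP.≟ v
  ... | yes _ = refl
  ... | no ¬p with ¬p refl
  ...   | ()

IsProperColouring : ∀ {n} → Graph n → (k : ℕ) → (Fin n → Fin k) → Set
IsProperColouring G k c = ∀ u v → adj G u v ≡ true → c u ≢ c v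

Colourable : ∀ {n} → Graph n → ℕ → Set
Colourable {n} G k = Data.Product.Σ (Fin n → Fin k) (IsProperColouring G k)

IsChromaticNumber : ∀ {n} → Graph n → ℕ → Set
IsChromaticNumber G k = Colourable G k × (∀ m → Colourable G m → k ≤ m)

IsNG : ∀ {n} → Graph n → Set
IsNG {n} G = ∀ k k' → IsChromaticNumber G k → IsChromaticNumber (complement G) k' →
             k Data.Nat.+ k' ≡ suc n

nbhd : ∀ {n} → Graph n → Fin n → Subset n
nbhd G v = tabulate (adj G v)

deg : ∀ {n} → Graph n → Fin n → ℕ
deg G v = ∣ nbhd G v ∣

-- ABC-partition relative to χ(G) = k  (deg v = k - 1, > k - 1, < k - 1;
-- written without truncated subtraction: suc deg = k, k < suc deg, suc deg < k)
Aset : ∀ {n} → Graph n → ℕ → Subset n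
Aset G k = tabulate (λ v → ⌊ suc (deg G v) ≟ k ⌋)

Bset : ∀ {n} → Graph n → ℕ → Subset n
Bset G k = tabulate (λ v → ⌊ k <? suc (deg G v) ⌋)

Cset : ∀ {n} → Graph n → ℕ → Subset n
Cset G k = tabulate (λ v → ⌊ suc (deg G v) <? k ⌋)

VminusA : ∀ {n} → Graph n → ℕ → Subset n
VminusA G k = tabulate (λ v → not ⌊ suc (deg G v) ≟ k ⌋)

-- cliques / stable sets (of G; for sets inside U they are exactly the
-- cliques / stable sets of the induced subgraph G[U])
IsClique : ∀ {n} → Graph n → Subset n → Set
IsClique G X = ∀ u v → u ∈ X → v ∈ X → u ≢ v → adj G u v ≡ true

IsStable : ∀ {n} → Graph n → Subset n → Set
IsStable G X = ∀ u v → u ∈ X → v ∈ X → adj G u v ≡ false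

IsKSPartition : ∀ {n} → Graph n → (U K S : Subset n) → Set
IsKSPartition G U K S = (K ∪ S ≡ U) × (K ∩ S ≡ ⊥) × IsClique G K × IsStable G S

-- K-max: |K| = ω(G[U]);  S-max: |S| = α(G[U])
IsKMax : ∀ {n} → Graph n → (U K : Subset n) → Set
IsKMax G U K = ∀ T → T ⊆ U → IsClique G T → ∣ T ∣ ≤ ∣ K ∣

IsSMax : ∀ {n} → Graph n → (U S : Subset n) → Set
IsSMax G U S = ∀ T → T ⊆ U → IsStable G T → ∣ T ∣ ≤ ∣ S ∣

IsNG1 : ∀ {n} → Graph n → ℕ → Set
IsNG1 G k = IsNG G × IsClique G (Aset G k)

IsNG2 : ∀ {n} → Graph n → ℕ → Set
IsNG2 G k = IsNG G × IsStable G (Aset G k)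

module Submission where

-- Everything rests on an edge rule for complementary X, Y with χ(X) + χ(Y) = n + 1:
-- no edge uv of X has deg u < χ(X) and deg v < χ(X) - 1. It follows from the
-- Nordhaus–Gaddum bound χ(X[U]) + χ(Y[U]) ≤ |U| + 1 (induction on |U| with greedy
-- colour extensions) applied to U = V ∖ {u, v}. As deg_Ḡ v = n - 1 - deg_G v, the
-- rule in G and in Ḡ makes C stable, B a clique, A complete to B and anticomplete
-- to C. For NG-1, A ∪ B is a clique, so by ω ≤ χ each b ∈ B has a neighbour in C
-- and a stable subset of B ∪ C can trade its one B-vertex for a C-vertex; NG-2 is
-- the same argument in Ḡ.

open import Defs
open import Data.Bool using (Bool; true; false; not; if_then_else_)
open import Data.Bool.Properties using (not-involutive) renaming (_≟_ to _≟ᵇ_)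
open import Data.Empty using (⊥; ⊥-elim)
open import Data.Fin using (Fin; zero; suc; toℕ; fromℕ<)
open import Data.Fin.Properties using (any?; all?; toℕ-fromℕ<; toℕ-injective; toℕ<n)
  renaming (_≟_ to _≟ᶠ_)
open import Data.Fin.Subset hiding (⊥)
open import Data.Fin.Subset.Properties
open import Data.Nat using (ℕ; zero; suc; pred; _+_; _≤_; _<_; z≤n; s≤s)
open import Data.Nat.Properties
open import Data.Product using (∃; ∃-syntax; _×_; _,_; proj₁; proj₂; uncurry)
open import Data.Sum using (_⊎_; inj₁; inj₂; assocˡ; swap)
open import Data.Vec using (_∷_; []; tabulate; here; there)
open import Data.Vec.Properties using (lookup∘tabulate; []=⇒lookup; lookup⇒[]=)
open import Data.Vec.Functional using () renaming (_∷_ to _∷ᶠ_)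
open import Function using (_∘_; id)
open import Relation.Nullary using (¬_; Dec; yes; no; does; contradiction)
open import Relation.Nullary.Decidable
  using (⌊_⌋; isYes≗does; dec-true; dec-false; _×-dec_; _⊎-dec_; _→-dec_; ¬?; map′)
open import Relation.Binary using (tri<; tri≈; tri>)
open import Relation.Binary.PropositionalEquality

private
  variable
    n : ℕ

clash : {b : Bool} → b ≡ true → b ≡ false → ⊥
clash refl ()

∈-tabulate⁻ : (f : Fin n → Bool) {x : Fin n} → x ∈ tabulate f → f x ≡ true
∈-tabulate⁻ f {x} x∈ = trans (sym (lookup∘tabulate f x)) ([]=⇒lookup x∈)

∈-tabulate⁺ : (f : Fin n → Bool) {x : Fin n} → f x ≡ true → x ∈ tabulate f
∈-tabulate⁺ f {x} fx≡true = lookup⇒[]= x _ (trans (lookup∘tabulate f x) fx≡true)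

module _ {P : Fin n → Set} (P? : ∀ v → Dec (P v)) {x : Fin n} where

  ∈-decided⁻ : x ∈ tabulate (λ v → ⌊ P? v ⌋) → P x
  ∈-decided⁻ x∈ with P? x | ∈-tabulate⁻ (λ v → ⌊ P? v ⌋) x∈
  ... | yes Px | _ = Px

  ∈-decided⁺ : P x → x ∈ tabulate (λ v → ⌊ P? v ⌋)
  ∈-decided⁺ Px = ∈-tabulate⁺ (λ v → ⌊ P? v ⌋) (trans (isYes≗does (P? x)) (dec-true (P? x) Px))

  ∉-decided⁻ : x ∈ tabulate (λ v → not ⌊ P? v ⌋) → ¬ P x
  ∉-decided⁻ x∈ with P? x | ∈-tabulate⁻ (λ v → not ⌊ P? v ⌋) x∈
  ... | no ¬Px | _ = ¬Px

  ∉-decided⁺ : ¬ P x → x ∈ tabulate (λ v → not ⌊ P? v ⌋)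
  ∉-decided⁺ ¬Px =
    ∈-tabulate⁺ (λ v → not ⌊ P? v ⌋) (cong not (trans (isYes≗does (P? x)) (dec-false (P? x) ¬Px)))

x∈p─q⇒x∉q : (p q : Subset n) {x : Fin n} → x ∈ p ─ q → x ∉ q
x∈p─q⇒x∉q (_ ∷ p) (outside ∷ q) here        = λ ()
x∈p─q⇒x∉q (_ ∷ p) (_       ∷ q) (there x∈) = x∈p─q⇒x∉q p q x∈ ∘ drop-there

x∈p-y⇒x≢y : {p : Subset n} {x y : Fin n} → x ∈ p - y → x ≢ y
x∈p-y⇒x≢y {p = p} {y = y} x∈ refl = x∈p─q⇒x∉q p ⁅ y ⁆ x∈ (x∈⁅x⁆ y)

∣p∣≡1+∣p-x∣ : {p : Subset n} {x : Fin n} → x ∈ p → ∣ p ∣ ≡ suc ∣ p - x ∣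
∣p∣≡1+∣p-x∣ {p = inside ∷ p}  here       = cong (suc ∘ ∣_∣) (sym (p─⊥≡p p))
∣p∣≡1+∣p-x∣ {p = inside ∷ p}  (there x∈) = cong suc (∣p∣≡1+∣p-x∣ x∈)
∣p∣≡1+∣p-x∣ {p = outside ∷ p} (there x∈) = ∣p∣≡1+∣p-x∣ x∈

empty-size : {p : Subset n} → Empty p → ∣ p ∣ ≡ 0
empty-size {n} p-empty = trans (cong ∣_∣ (Empty-unique p-empty)) (∣⊥∣≡0 n)

∣p∪q∣≤∣p∣+∣q∣ : (p q : Subset n) → ∣ p ∪ q ∣ ≤ ∣ p ∣ + ∣ q ∣
∣p∪q∣≤∣p∣+∣q∣ []            []            = z≤n
∣p∪q∣≤∣p∣+∣q∣ (inside  ∷ p) (s       ∷ q) =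
  s≤s (≤-trans (∣p∪q∣≤∣p∣+∣q∣ p q) (+-monoʳ-≤ ∣ p ∣ (∣p∣≤∣x∷p∣ s q)))
∣p∪q∣≤∣p∣+∣q∣ (outside ∷ p) (inside  ∷ q) =
  ≤-trans (s≤s (∣p∪q∣≤∣p∣+∣q∣ p q)) (≤-reflexive (sym (+-suc ∣ p ∣ ∣ q ∣)))
∣p∪q∣≤∣p∣+∣q∣ (outside ∷ p) (outside ∷ q) = ∣p∪q∣≤∣p∣+∣q∣ p q

∣p∪q∣≡∣p∣+∣q∣ : (p q : Subset n) → Empty (p ∩ q) → ∣ p ∪ q ∣ ≡ ∣ p ∣ + ∣ q ∣
∣p∪q∣≡∣p∣+∣q∣ []            []            _        = refl
∣p∪q∣≡∣p∣+∣q∣ (inside  ∷ p) (inside  ∷ q) disjoint = contradiction (zero , here) disjoint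
∣p∪q∣≡∣p∣+∣q∣ (inside  ∷ p) (outside ∷ q) disjoint =
  cong suc (∣p∪q∣≡∣p∣+∣q∣ p q (drop-∷-Empty disjoint))
∣p∪q∣≡∣p∣+∣q∣ (outside ∷ p) (inside  ∷ q) disjoint =
  trans (cong suc (∣p∪q∣≡∣p∣+∣q∣ p q (drop-∷-Empty disjoint))) (sym (+-suc ∣ p ∣ ∣ q ∣))
∣p∪q∣≡∣p∣+∣q∣ (outside ∷ p) (outside ∷ q) disjoint = ∣p∪q∣≡∣p∣+∣q∣ p q (drop-∷-Empty disjoint)

cover-size : {p q r : Subset n} → r ⊆ p ∪ q → ∣ r ∣ ≤ ∣ p ∣ + ∣ q ∣
cover-size {p = p} {q} r⊆p∪q = ≤-trans (p⊆q⇒∣p∣≤∣q∣ r⊆p∪q) (∣p∪q∣≤∣p∣+∣q∣ p q)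

partition-size : {p q r : Subset n} → p ⊆ r → q ⊆ r → r ⊆ p ∪ q → Empty (p ∩ q) →
                 ∣ r ∣ ≡ ∣ p ∣ + ∣ q ∣
partition-size {p = p} {q} {r} p⊆r q⊆r r⊆p∪q disjoint =
  trans (cong ∣_∣ (⊆-antisym r⊆p∪q p∪q⊆r)) (∣p∪q∣≡∣p∣+∣q∣ p q disjoint)
  where
  p∪q⊆r : p ∪ q ⊆ r
  p∪q⊆r x∈ with x∈p∪q⁻ p q x∈
  ... | inj₁ x∈p = p⊆r x∈p
  ... | inj₂ x∈q = q⊆r x∈q

free-colour : (f : Fin n → ℕ) (m : ℕ) (N : Subset n) → ∣ N ∣ < m →
              ∃[ c ] c < m × (∀ {w} → w ∈ N → f w ≢ c)
free-colour f (suc m) N ∣N∣<1+m with any? (λ w → (w ∈? N) ×-dec (f w ≟ m))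
... | no m-unused = m , n<1+n m , λ w∈N fw≡m → m-unused (_ , w∈N , fw≡m)
... | yes (w₀ , w₀∈N , fw₀≡m)
  with free-colour f m (N - w₀) (<-≤-trans (x∈p⇒∣p-x∣<∣p∣ w₀∈N) (≤-pred ∣N∣<1+m))
...   | c , c<m , unused-off-w₀ = c , m<n⇒m<1+n c<m , unused
  where
  -- Recursing on N - w₀ is enough: w₀ itself has colour m ≠ c.
  unused : ∀ {w} → w ∈ N → f w ≢ c
  unused {w} w∈N with w ≟ᶠ w₀
  ... | yes refl = λ fw≡c → <⇒≢ c<m (trans (sym fw≡c) fw₀≡m)
  ... | no w≢w₀  = unused-off-w₀ (x∈p∧x≢y⇒x∈p-y w∈N w≢w₀)

injective-size : (f : Fin n → ℕ) (k : ℕ) (T : Subset n) → (∀ {u} → u ∈ T → f u < k) →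
                 (∀ {u v} → u ∈ T → v ∈ T → u ≢ v → f u ≢ f v) → ∣ T ∣ ≤ k
injective-size f zero T bounded _ = ≤-reflexive (empty-size (λ (u , u∈T) → n≮0 (bounded u∈T)))
injective-size f (suc k) T bounded injective with any? (λ t → (t ∈? T) ×-dec (f t ≟ k))
... | no k-unused = m≤n⇒m≤1+n (injective-size f k T below-k injective)
  where
  below-k : ∀ {u} → u ∈ T → f u < k
  below-k u∈T = ≤∧≢⇒< (≤-pred (bounded u∈T)) (λ fu≡k → k-unused (_ , u∈T , fu≡k))
... | yes (t , t∈T , ft≡k) = begin
  ∣ T ∣          ≡⟨ ∣p∣≡1+∣p-x∣ t∈T ⟩
  suc ∣ T - t ∣  ≤⟨ s≤s (injective-size f k (T - t) below-k
                           (λ u∈ v∈ → injective (inT u∈) (inT v∈))) ⟩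
  suc k          ∎
  where
  open ≤-Reasoning
  inT : ∀ {u} → u ∈ T - t → u ∈ T
  inT = p─q⊆p T ⁅ t ⁆
  -- Only t has colour k, so T - t uses colours < k.
  below-k : ∀ {u} → u ∈ T - t → f u < k
  below-k u∈ = ≤∧≢⇒< (≤-pred (bounded (inT u∈)))
                      (λ fu≡k → injective (inT u∈) t∈T (x∈p-y⇒x≢y u∈) (trans fu≡k (sym ft≡k)))

record PartialColouring (X : Graph n) (P : Fin n → Set) (a : ℕ) : Set where
  field
    colour  : Fin n → ℕ
    bounded : ∀ {u} → P u → colour u < a
    proper  : ∀ {u v} → P u → P v → adj X u v ≡ true → colour u ≢ colour v
open PartialColouring

infixl 5 _▹_
_▹_ : (Fin n → Set) → Fin n → Fin n → Set
(P ▹ x) w = P w ⊎ w ≡ x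

restrict : {X : Graph n} {P Q : Fin n → Set} {a : ℕ} →
           PartialColouring X P a → (∀ {w} → Q w → P w) → PartialColouring X Q a
restrict f Q⊆P = record
  { colour  = colour f
  ; bounded = bounded f ∘ Q⊆P
  ; proper  = λ Qu Qv → proper f (Q⊆P Qu) (Q⊆P Qv)
  }

paint : {X : Graph n} {P S : Fin n → Set} {a m c : ℕ} →
        (f : PartialColouring X P a) → (∀ w → Dec (S w)) →
        (∀ {s t} → S s → S t → adj X s t ≡ false) → a ≤ m → c < m →
        (∀ {s w} → S s → P w → adj X s w ≡ true → colour f w ≢ c) →
        PartialColouring X (λ w → P w ⊎ S w) m
paint {n} {X} {P} {S} {m = m} {c} f S? stable a≤m c<m avoids = record
  { colour = painted ; bounded = painted-bounded ; proper = painted-proper }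
  where
  painted : Fin n → ℕ
  painted w = if does (S? w) then c else colour f w
  old : ∀ {w} → P w ⊎ S w → ¬ S w → P w
  old (inj₁ Pw) _   = Pw
  old (inj₂ Sw) ¬Sw = contradiction Sw ¬Sw
  painted-bounded : ∀ {u} → P u ⊎ S u → painted u < m
  painted-bounded {u} u∈ with S? u
  ... | yes _   = c<m
  ... | no ¬Su  = <-≤-trans (bounded f (old u∈ ¬Su)) a≤m
  painted-proper : ∀ {u v} → P u ⊎ S u → P v ⊎ S v → adj X u v ≡ true → painted u ≢ painted v
  painted-proper {u} {v} u∈ v∈ uv with S? u | S? v
  ... | yes Su  | yes Sv  = λ _ → clash uv (stable Su Sv)
  ... | yes Su  | no ¬Sv  = avoids Su (old v∈ ¬Sv) uv ∘ sym
  ... | no ¬Su  | yes Sv  = avoids Sv (old u∈ ¬Su) (trans (symm X v u) uv)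
  ... | no ¬Su  | no ¬Sv  = proper f (old u∈ ¬Su) (old v∈ ¬Sv) uv

add-colour-class : {X : Graph n} {P S : Fin n → Set} {a : ℕ} →
                   PartialColouring X P a → (∀ w → Dec (S w)) →
                   (∀ {s t} → S s → S t → adj X s t ≡ false) →
                   PartialColouring X (λ w → P w ⊎ S w) (suc a)
add-colour-class f S? stable =
  paint f S? stable (n≤1+n _) ≤-refl (λ _ Pw _ → <⇒≢ (bounded f Pw))

singleton-stable : {X : Graph n} {x s t : Fin n} → s ≡ x → t ≡ x → adj X s t ≡ false
singleton-stable {X = X} refl refl = irrefl X _

extend-fresh : {X : Graph n} {P : Fin n → Set} {a : ℕ} {x : Fin n} →
               PartialColouring X P a → PartialColouring X (P ▹ x) (suc a)
extend-fresh {X = X} {x = x} f = add-colour-class f (_≟ᶠ x) (singleton-stable {X = X})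

extend-greedy : {X : Graph n} {P : Fin n → Set} {a m : ℕ} {x : Fin n} →
                PartialColouring X P a → a ≤ m → (N : Subset n) → ∣ N ∣ < m →
                (∀ {w} → P w → adj X x w ≡ true → w ∈ N) → PartialColouring X (P ▹ x) m
extend-greedy {X = X} {x = x} f a≤m N ∣N∣<m neighbours-in-N
  with free-colour (colour f) _ N ∣N∣<m
... | c , c<m , c-unused =
  paint f (_≟ᶠ x) (singleton-stable {X = X}) a≤m c<m
        (λ { refl Pw xw → c-unused (neighbours-in-N Pw xw) })

χ-minimal : {X : Graph n} {k m : ℕ} → IsChromaticNumber X k → PartialColouring X (_∈ ⊤) m → k ≤ m
χ-minimal {n} {X} {m = m} (_ , minimal) f = minimal m (fin-colour , fin-proper)
  where
  fin-colour : Fin n → Fin m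
  fin-colour w = fromℕ< (bounded f (∈⊤ {x = w}))
  fin-proper : IsProperColouring X m fin-colour
  fin-proper u v uv same = proper f ∈⊤ ∈⊤ uv
    (trans (sym (toℕ-fromℕ< _)) (trans (cong toℕ same) (toℕ-fromℕ< _)))

record Complementary (X Y : Graph n) : Set where
  field
    flip : ∀ {u v} → u ≢ v → adj Y u v ≡ not (adj X u v)
open Complementary

complementary-sym : {X Y : Graph n} → Complementary X Y → Complementary Y X
complementary-sym co .flip u≢v = trans (sym (not-involutive _)) (cong not (sym (flip co u≢v)))

complement-complementary : (G : Graph n) → Complementary G (complement G)
complement-complementary G .flip {u} {v} u≢v with u ≟ᶠ v
... | yes u≡v = contradiction u≡v u≢v
... | no _    = refl

non-edge⇒co-edge : {X Y : Graph n} → Complementary X Y → ∀ {u v} → u ≢ v →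
                   adj X u v ≡ false → adj Y u v ≡ true
non-edge⇒co-edge co u≢v uv = trans (flip co u≢v) (cong not uv)

edge⇒co-non-edge : {X Y : Graph n} → Complementary X Y → ∀ {u v} → u ≢ v →
                   adj X u v ≡ true → adj Y u v ≡ false
edge⇒co-non-edge co u≢v uv = trans (flip co u≢v) (cong not uv)

∈nbhd⁻ : (X : Graph n) {x w : Fin n} → w ∈ nbhd X x → adj X x w ≡ true
∈nbhd⁻ X {x} = ∈-tabulate⁻ (adj X x)

∈nbhd⁺ : (X : Graph n) {x w : Fin n} → adj X x w ≡ true → w ∈ nbhd X x
∈nbhd⁺ X {x} = ∈-tabulate⁺ (adj X x)

not-in-own-nbhd : (X : Graph n) {x : Fin n} → x ∉ nbhd X x
not-in-own-nbhd X {x} x∈ = clash (∈nbhd⁻ X x∈) (irrefl X x)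

complement-split : {X Y : Graph n} → Complementary X Y → (r : Subset n) {x : Fin n} → x ∉ r →
                   ∣ r ∣ ≡ ∣ r ∩ nbhd X x ∣ + ∣ r ∩ nbhd Y x ∣
complement-split {X = X} {Y} co r {x} x∉r =
  partition-size (p∩q⊆p r _) (p∩q⊆p r _) covered disjoint
  where
  x≢ : ∀ {w} → w ∈ r → x ≢ w
  x≢ w∈r refl = x∉r w∈r
  covered : r ⊆ (r ∩ nbhd X x) ∪ (r ∩ nbhd Y x)
  covered {w} w∈r with adj X x w in xw
  ... | true  = x∈p∪q⁺ (inj₁ (x∈p∩q⁺ (w∈r , ∈nbhd⁺ X xw)))
  ... | false = x∈p∪q⁺ (inj₂ (x∈p∩q⁺ (w∈r , ∈nbhd⁺ Y (non-edge⇒co-edge co (x≢ w∈r) xw))))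
  disjoint : Empty ((r ∩ nbhd X x) ∩ (r ∩ nbhd Y x))
  disjoint (w , w∈) with x∈p∩q⁻ (r ∩ nbhd X x) _ w∈
  ... | inX , inY with x∈p∩q⁻ r _ inX | x∈p∩q⁻ r _ inY
  ...   | w∈r , xw | _ , xwᶜ =
    clash (∈nbhd⁻ Y xwᶜ) (edge⇒co-non-edge co (x≢ w∈r) (∈nbhd⁻ X xw))

record NGColouring (X Y : Graph n) (P : Fin n → Set) (m : ℕ) : Set where
  constructor ngColouring
  field
    a b    : ℕ
    colX   : PartialColouring X P a
    colY   : PartialColouring Y P b
    budget : a + b ≤ suc m

ng-swap : {X Y : Graph n} {P : Fin n → Set} {m : ℕ} → NGColouring X Y P m → NGColouring Y X P m
ng-swap {m = m} (ngColouring a b colX colY budget) =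
  ngColouring b a colY colX (subst (_≤ suc m) (+-comm a b) budget)

ng-greedy : {X Y : Graph n} {P : Fin n → Set} {m : ℕ} {x : Fin n} (c : NGColouring X Y P m) →
            (N : Subset n) → ∣ N ∣ < NGColouring.a c → (∀ {w} → P w → adj X x w ≡ true → w ∈ N) →
            NGColouring X Y (P ▹ x) (suc m)
ng-greedy (ngColouring a b colX colY budget) N ∣N∣<a neighbours-in-N =
  ngColouring a (suc b) (extend-greedy colX ≤-refl N ∣N∣<a neighbours-in-N) (extend-fresh colY)
              (≤-trans (≤-reflexive (+-suc a b)) (s≤s budget))

ng-fresh : {X Y : Graph n} {P : Fin n → Set} {m : ℕ} {x : Fin n} (c : NGColouring X Y P m) →
           NGColouring.a c + NGColouring.b c ≤ m → NGColouring X Y (P ▹ x) (suc m)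
ng-fresh (ngColouring a b colX colY _) a+b≤m =
  ngColouring (suc a) (suc b) (extend-fresh colX) (extend-fresh colY)
              (s≤s (≤-trans (≤-reflexive (+-suc a b)) (s≤s a+b≤m)))

-- Adding one vertex x ∉ U: one of the three extensions above always applies,
-- because x has |U| neighbours in X and Y together.
ng-step : {X Y : Graph n} → Complementary X Y → (U : Subset n) {x : Fin n} → x ∉ U →
          NGColouring X Y (_∈ U) ∣ U ∣ → NGColouring X Y ((_∈ U) ▹ x) (suc ∣ U ∣)
ng-step {X = X} {Y} co U {x} x∉U c@(ngColouring a b _ _ _)
  with ∣ U ∩ nbhd X x ∣ <? a | ∣ U ∩ nbhd Y x ∣ <? b
... | yes dX<a | _ = ng-greedy c (U ∩ nbhd X x) dX<a λ w∈U xw → x∈p∩q⁺ (w∈U , ∈nbhd⁺ X xw)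
... | no _ | yes dY<b =
  ng-swap (ng-greedy (ng-swap c) (U ∩ nbhd Y x) dY<b λ w∈U xw → x∈p∩q⁺ (w∈U , ∈nbhd⁺ Y xw))
... | no dX≮a | no dY≮b = ng-fresh c (begin
  a + b                               ≤⟨ +-mono-≤ (≮⇒≥ dX≮a) (≮⇒≥ dY≮b) ⟩
  ∣ U ∩ nbhd X x ∣ + ∣ U ∩ nbhd Y x ∣ ≡⟨ complement-split co U x∉U ⟨
  ∣ U ∣                               ∎)
  where open ≤-Reasoning

ng-bound : {X Y : Graph n} → Complementary X Y → (U : Subset n) → NGColouring X Y (_∈ U) ∣ U ∣
ng-bound {n} {X} {Y} co U = by-size ∣ U ∣ U refl
  where
  empty-colouring : {Z : Graph n} {V : Subset n} → Empty V → PartialColouring Z (_∈ V) 0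
  empty-colouring V-empty = record
    { colour = λ _ → 0
    ; bounded = λ u∈ → contradiction (_ , u∈) V-empty
    ; proper = λ u∈ _ _ → contradiction (_ , u∈) V-empty
    }
  by-size : ∀ m (V : Subset n) → ∣ V ∣ ≡ m → NGColouring X Y (_∈ V) ∣ V ∣
  by-size m V ∣V∣≡m with nonempty? V
  ... | no V-empty = ngColouring 0 0 (empty-colouring V-empty) (empty-colouring V-empty) z≤n
  by-size zero    V ∣V∣≡0   | yes (x , x∈V) =
    contradiction (trans (sym ∣V∣≡0) (∣p∣≡1+∣p-x∣ x∈V)) 0≢1+n
  by-size (suc m) V ∣V∣≡1+m | yes (x , x∈V) =
    record { NGColouring extended
           ; colX = restrict colX V⊆ ; colY = restrict colY V⊆
           ; budget = subst (λ s → a + b ≤ suc s) (sym (∣p∣≡1+∣p-x∣ x∈V)) budget }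
    where
    extended : NGColouring X Y ((_∈ V - x) ▹ x) (suc ∣ V - x ∣)
    extended = ng-step co (V - x) (λ x∈ → x∈p-y⇒x≢y x∈ refl)
      (by-size m (V - x) (suc-injective (trans (sym (∣p∣≡1+∣p-x∣ x∈V)) ∣V∣≡1+m)))
    open NGColouring extended
    V⊆ : ∀ {w} → w ∈ V → ((_∈ V - x) ▹ x) w
    V⊆ {w} w∈V with w ≟ᶠ x
    ... | yes w≡x = inj₂ w≡x
    ... | no w≢x  = inj₁ (x∈p∧x≢y⇒x∈p-y w∈V w≢x)

∃-function? : ∀ n m (P : (Fin n → Fin m) → Set) →
              (∀ {f g} → (∀ x → f x ≡ g x) → P f → P g) → (∀ f → Dec (P f)) → Dec (∃ P)
∃-function? zero    m P P-ext P? = map′ (λ p → _ , p) (λ (f , p) → P-ext (λ ()) p) (P? (λ ()))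
∃-function? (suc n) m P P-ext P? =
  map′ (λ (x , g , p) → x ∷ᶠ g , p) (λ (f , p) → f zero , f ∘ suc , P-ext head∷tail p)
       (any? λ x → ∃-function? n m (P ∘ (x ∷ᶠ_)) (λ g≗h → P-ext (cons-ext g≗h)) (P? ∘ (x ∷ᶠ_)))
  where
  head∷tail : {f : Fin (suc n) → Fin m} → ∀ i → f i ≡ (f zero ∷ᶠ f ∘ suc) i
  head∷tail zero    = refl
  head∷tail (suc i) = refl
  cons-ext : {x : Fin m} {g h : Fin n → Fin m} → (∀ i → g i ≡ h i) → ∀ i → (x ∷ᶠ g) i ≡ (x ∷ᶠ h) i
  cons-ext g≗h zero    = refl
  cons-ext g≗h (suc i) = g≗h i

colourable? : (X : Graph n) (m : ℕ) → Dec (Colourable X m)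
colourable? {n} X m = ∃-function? n m (IsProperColouring X m) respects proper?
  where
  respects : ∀ {f g} → (∀ x → f x ≡ g x) → IsProperColouring X m f → IsProperColouring X m g
  respects f≗g f-proper u v uv gu≡gv = f-proper u v uv (trans (f≗g u) (trans gu≡gv (sym (f≗g v))))
  proper? : ∀ f → Dec (IsProperColouring X m f)
  proper? f = all? λ u → all? λ v → (adj X u v ≟ᵇ true) →-dec ¬? (f u ≟ᶠ f v)

least-witness : (P : ℕ → Set) → (∀ m → Dec (P m)) → ∀ w → P w →
                ∃[ k ] P k × (∀ m → P m → k ≤ m)
least-witness P P? w Pw with P? 0
... | yes P0 = 0 , P0 , λ _ _ → z≤n
least-witness P P? zero    P0 | no ¬P0 = contradiction P0 ¬P0
least-witness P P? (suc w) Pw | no ¬P0 with least-witness (P ∘ suc) (P? ∘ suc) w Pw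
... | k , Pk , k-least = suc k , Pk , above
  where
  above : ∀ m → P m → suc k ≤ m
  above zero    P0 = contradiction P0 ¬P0
  above (suc m) Pm = s≤s (k-least m Pm)

chromatic-number : (X : Graph n) → ∃ (IsChromaticNumber X)
chromatic-number {n} X = least-witness (Colourable X) (colourable? X) n (id , distinct)
  where
  distinct : IsProperColouring X n id
  distinct u _ uu refl = clash uu (irrefl X u)

module EdgeRule {X Y : Graph n} (co : Complementary X Y) {kX kY : ℕ}
                (χX : IsChromaticNumber X kX) (χY : IsChromaticNumber Y kY)
                (ng-sum : kX + kY ≡ suc n) where

  private module _ {u v : Fin n} (u≢v : u ≢ v) (uv : adj X u v ≡ true) where

    rest : Subset n
    rest = ⊤ - u - v

    n≡2+∣rest∣ : n ≡ suc (suc ∣ rest ∣)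
    n≡2+∣rest∣ = begin
      n                        ≡⟨ ∣⊤∣≡n n ⟨
      ∣ ⊤ {n} ∣                ≡⟨ ∣p∣≡1+∣p-x∣ (∈⊤ {x = u}) ⟩
      suc ∣ ⊤ - u ∣            ≡⟨ cong suc (∣p∣≡1+∣p-x∣ (x∈p∧x≢y⇒x∈p-y ∈⊤ (u≢v ∘ sym))) ⟩
      suc (suc ∣ rest ∣)       ∎
      where open ≡-Reasoning

    every-vertex : ∀ w → w ∈ rest ⊎ (w ≡ u ⊎ w ≡ v)
    every-vertex w with w ≟ᶠ u | w ≟ᶠ v
    ... | yes w≡u | _       = inj₂ (inj₁ w≡u)
    ... | no _    | yes w≡v = inj₂ (inj₂ w≡v)
    ... | no w≢u  | no w≢v  = inj₁ (x∈p∧x≢y⇒x∈p-y (x∈p∧x≢y⇒x∈p-y ∈⊤ w≢u) w≢v)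

    open NGColouring (ng-bound co rest)

    -- u and v are non-adjacent in Y, so they can share one new colour: χ(Y) ≤ b + 1.
    kY≤1+b : kY ≤ suc b
    kY≤1+b = χ-minimal χY (restrict (add-colour-class colY u,v? u,v-stable) (λ {w} _ → every-vertex w))
      where
      u,v? : ∀ w → Dec (w ≡ u ⊎ w ≡ v)
      u,v? w = (w ≟ᶠ u) ⊎-dec (w ≟ᶠ v)
      u,v-stable : ∀ {s t} → s ≡ u ⊎ s ≡ v → t ≡ u ⊎ t ≡ v → adj Y s t ≡ false
      u,v-stable (inj₁ refl) (inj₁ refl) = irrefl Y u
      u,v-stable (inj₁ refl) (inj₂ refl) = edge⇒co-non-edge co u≢v uv
      u,v-stable (inj₂ refl) (inj₁ refl) = trans (symm Y v u) (edge⇒co-non-edge co u≢v uv)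
      u,v-stable (inj₂ refl) (inj₂ refl) = irrefl Y v

    -- Hence X[rest] is coloured with fewer than χ(X) colours, since otherwise
    -- χ(X) + χ(Y) ≤ a + b + 1 ≤ n.
    a<kX : a < kX
    a<kX = ≰⇒> λ kX≤a → 1+n≰n (begin
      suc n          ≡⟨ ng-sum ⟨
      kX + kY        ≤⟨ +-mono-≤ kX≤a kY≤1+b ⟩
      a + suc b      ≡⟨ +-suc a b ⟩
      suc (a + b)    ≤⟨ s≤s budget ⟩
      suc (suc ∣ rest ∣) ≡⟨ n≡2+∣rest∣ ⟨
      n              ∎)
      where open ≤-Reasoning

    greedy : ∀ {m} → a ≤ m → deg X u ≤ m → deg X v < m → PartialColouring X (_∈ ⊤) m
    greedy {m} a≤m deg-u≤m deg-v<m = restrict with-v (λ {w} _ → assocˡ (every-vertex w))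
      where
      u-neighbours : ∀ {w} → w ∈ rest → adj X u w ≡ true → w ∈ nbhd X u - v
      u-neighbours w∈rest uw = x∈p∧x≢y⇒x∈p-y (∈nbhd⁺ X uw) (x∈p-y⇒x≢y w∈rest)
      with-u : PartialColouring X ((_∈ rest) ▹ u) m
      with-u = extend-greedy colX a≤m (nbhd X u - v)
                 (<-≤-trans (x∈p⇒∣p-x∣<∣p∣ (∈nbhd⁺ X uv)) deg-u≤m) u-neighbours
      with-v : PartialColouring X ((_∈ rest) ▹ u ▹ v) m
      with-v = extend-greedy with-u ≤-refl (nbhd X v) deg-v<m (λ _ vw → ∈nbhd⁺ X vw)

    -- So an edge uv with deg u < χ(X) and deg v < χ(X) - 1 would give χ(X) ≤ χ(X) - 1.
    no-such-edge : deg X u < kX → suc (deg X v) < kX → ⊥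
    no-such-edge deg-u<kX deg-v<kX-1 = <⇒≱ (pred<kX a<kX) (χ-minimal χX
      (greedy (<⇒≤pred a<kX) (<⇒≤pred deg-u<kX) (<⇒≤pred deg-v<kX-1)))
      where
      pred<kX : ∀ {j} → j < kX → pred kX < kX
      pred<kX (s≤s _) = ≤-refl

  edge-rule : ∀ {u v} → deg X u < kX → suc (deg X v) < kX → adj X u v ≡ false
  edge-rule {u} {v} deg-u deg-v with adj X u v in uv
  ... | false = refl
  ... | true  = ⊥-elim (no-such-edge u≢v uv deg-u deg-v)
    where
    u≢v : u ≢ v
    u≢v refl = clash uv (irrefl X u)

∪-clique : {X : Graph n} {P Q : Subset n} → IsClique X P → IsClique X Q →
           (∀ {p q} → p ∈ P → q ∈ Q → adj X p q ≡ true) → IsClique X (P ∪ Q)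
∪-clique {X = X} {P} {Q} P-clique Q-clique complete u v u∈ v∈ u≢v
  with x∈p∪q⁻ P Q u∈ | x∈p∪q⁻ P Q v∈
... | inj₁ u∈P | inj₁ v∈P = P-clique u v u∈P v∈P u≢v
... | inj₁ u∈P | inj₂ v∈Q = complete u∈P v∈Q
... | inj₂ u∈Q | inj₁ v∈P = trans (symm X u v) (complete v∈P u∈Q)
... | inj₂ u∈Q | inj₂ v∈Q = Q-clique u v u∈Q v∈Q u≢v

∪-stable : {X : Graph n} {P Q : Subset n} → IsStable X P → IsStable X Q →
           (∀ {p q} → p ∈ P → q ∈ Q → adj X p q ≡ false) → IsStable X (P ∪ Q)
∪-stable {X = X} {P} {Q} P-stable Q-stable anticomplete u v u∈ v∈
  with x∈p∪q⁻ P Q u∈ | x∈p∪q⁻ P Q v∈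
... | inj₁ u∈P | inj₁ v∈P = P-stable u v u∈P v∈P
... | inj₁ u∈P | inj₂ v∈Q = anticomplete u∈P v∈Q
... | inj₂ u∈Q | inj₁ v∈P = trans (symm X u v) (anticomplete v∈P u∈Q)
... | inj₂ u∈Q | inj₂ v∈Q = Q-stable u v u∈Q v∈Q

stable⇒co-clique : {X Y : Graph n} {S : Subset n} → Complementary X Y → IsStable X S → IsClique Y S
stable⇒co-clique co S-stable u v u∈ v∈ u≢v = non-edge⇒co-edge co u≢v (S-stable u v u∈ v∈)

clique⇒co-stable : {X Y : Graph n} {K : Subset n} → Complementary X Y → IsClique X K → IsStable Y K
clique⇒co-stable {Y = Y} co K-clique u v u∈ v∈ with u ≟ᶠ v
... | yes refl = irrefl Y u
... | no u≢v   = edge⇒co-non-edge co u≢v (K-clique u v u∈ v∈ u≢v)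

-- ω ≤ χ: the vertices of a clique receive pairwise different colours.
clique-size : {X : Graph n} {k : ℕ} {W : Subset n} →
              IsChromaticNumber X k → IsClique X W → ∣ W ∣ ≤ k
clique-size ((c , c-proper) , _) W-clique =
  injective-size (toℕ ∘ c) _ _ (λ {u} _ → toℕ<n (c u))
    (λ u∈ v∈ u≢v same → c-proper _ _ (W-clique _ _ u∈ v∈ u≢v) (toℕ-injective same))

-- A vertex v of a clique W whose neighbours all lie in W has deg v < |W| ≤ χ.
-- So if deg v ≥ χ, then v has a neighbour in any set Q covering the rest.
neighbour-outside : {X : Graph n} {k : ℕ} {W Q : Subset n} → IsChromaticNumber X k →
                    IsClique X W → (∀ w → w ∈ W ⊎ w ∈ Q) → ∀ {v} → v ∈ W →
                    k < suc (deg X v) → ∃[ q ] q ∈ Q × adj X v q ≡ true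
neighbour-outside {X = X} {k} {W} {Q} χ W-clique cover {v} v∈W k<1+deg
  with any? (λ q → (q ∈? Q) ×-dec (adj X v q ≟ᵇ true))
... | yes found = found
... | no none   = contradiction k<1+deg (≤⇒≯ (begin
  suc (deg X v)  ≤⟨ s≤s (p⊆q⇒∣p∣≤∣q∣ nbhd⊆W-v) ⟩
  suc ∣ W - v ∣  ≡⟨ ∣p∣≡1+∣p-x∣ v∈W ⟨
  ∣ W ∣          ≤⟨ clique-size {X = X} χ W-clique ⟩
  k              ∎))
  where
  open ≤-Reasoning
  nbhd⊆W-v : nbhd X v ⊆ W - v
  nbhd⊆W-v {w} w∈ with cover w
  ... | inj₁ w∈W = x∈p∧x≢y⇒x∈p-y w∈W (λ { refl → not-in-own-nbhd X w∈ })
  ... | inj₂ w∈Q = contradiction (w , w∈Q , ∈nbhd⁻ X w∈) none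

-- Exchange: let P be a clique each of whose vertices has a neighbour in Q.
-- A stable set T ⊆ P ∪ Q meets P in at most one vertex p, and then misses a
-- neighbour of p in Q; hence |T| ≤ |Q|.
stable-exchange : {X : Graph n} {P Q T : Subset n} → IsClique X P → IsStable X T →
                  (∀ {x} → x ∈ T → x ∈ P ⊎ x ∈ Q) →
                  (∀ {p} → p ∈ P → ∃[ q ] q ∈ Q × adj X p q ≡ true) → ∣ T ∣ ≤ ∣ Q ∣
stable-exchange {P = P} {Q} {T} P-clique T-stable T⊆P∪Q escape
  with any? (λ p → (p ∈? T) ×-dec (p ∈? P))
... | no T∩P-empty = p⊆q⇒∣p∣≤∣q∣ T⊆Q
  where
  T⊆Q : T ⊆ Q
  T⊆Q {x} x∈T with T⊆P∪Q x∈T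
  ... | inj₁ x∈P = contradiction (x , x∈T , x∈P) T∩P-empty
  ... | inj₂ x∈Q = x∈Q
... | yes (p , p∈T , p∈P) with escape p∈P
...   | q , q∈Q , pq = begin
  ∣ T ∣                    ≤⟨ cover-size T⊆ ⟩
  ∣ Q - q ∣ + ∣ ⁅ p ⁆ ∣    ≡⟨ cong (∣ Q - q ∣ +_) (∣⁅x⁆∣≡1 p) ⟩
  ∣ Q - q ∣ + 1            ≡⟨ +-comm _ 1 ⟩
  suc ∣ Q - q ∣            ≡⟨ ∣p∣≡1+∣p-x∣ q∈Q ⟨
  ∣ Q ∣                    ∎
  where
  open ≤-Reasoning
  q∉T : q ∉ T
  q∉T q∈T = clash pq (T-stable p q p∈T q∈T)
  T⊆ : T ⊆ (Q - q) ∪ ⁅ p ⁆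
  T⊆ {x} x∈T with x ≟ᶠ p
  ... | yes refl = x∈p∪q⁺ (inj₂ (x∈⁅x⁆ p))
  ... | no x≢p with T⊆P∪Q x∈T
  ...   | inj₁ x∈P = ⊥-elim (clash (P-clique x p x∈P p∈P x≢p) (T-stable x p x∈T p∈T))
  ...   | inj₂ x∈Q = x∈p∪q⁺ (inj₁ (x∈p∧x≢y⇒x∈p-y x∈Q λ { refl → q∉T x∈T }))

degree-sum : {X Y : Graph n} → Complementary X Y → ∀ v → suc (deg X v + deg Y v) ≡ n
degree-sum {n} {X} {Y} co v = begin
  suc (deg X v + deg Y v)
    ≡⟨ cong suc (cong₂ _+_ (within X) (within Y)) ⟨
  suc (∣ (⊤ - v) ∩ nbhd X v ∣ + ∣ (⊤ - v) ∩ nbhd Y v ∣)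
    ≡⟨ cong suc (complement-split co (⊤ {n} - v) v∉⊤-v) ⟨
  suc ∣ ⊤ - v ∣
    ≡⟨ ∣p∣≡1+∣p-x∣ (∈⊤ {x = v}) ⟨
  ∣ ⊤ {n} ∣
    ≡⟨ ∣⊤∣≡n n ⟩
  n ∎
  where
  open ≡-Reasoning
  v∉⊤-v : v ∉ ⊤ - v
  v∉⊤-v v∈ = x∈p-y⇒x≢y v∈ refl
  within : (Z : Graph n) → ∣ (⊤ - v) ∩ nbhd Z v ∣ ≡ deg Z v
  within Z = cong ∣_∣ (⊆-antisym (p∩q⊆q (⊤ - v) (nbhd Z v))
    (λ {w} w∈ → x∈p∩q⁺ (x∈p∧x≢y⇒x∈p-y ∈⊤ (λ { refl → not-in-own-nbhd Z w∈ }) , w∈)))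

+-balance-< : ∀ {x y z w} → x + y ≡ z + w → x < z → w < y
+-balance-< x+y≡z+w x<z = ≰⇒> λ y≤w → <-irrefl x+y≡z+w (+-mono-<-≤ x<z y≤w)

module NGGraph (G : Graph n) (k : ℕ) (χG : IsChromaticNumber G k) (ng : IsNG G) where

  Ḡ : Graph n
  Ḡ = complement G

  co : Complementary G Ḡ
  co = complement-complementary G

  k̄ : ℕ
  k̄ = proj₁ (chromatic-number Ḡ)

  χḠ : IsChromaticNumber Ḡ k̄
  χḠ = proj₂ (chromatic-number Ḡ)

  k+k̄≡1+n : k + k̄ ≡ suc n
  k+k̄≡1+n = ng k k̄ χG χḠ

  A B C V∖A : Subset n
  A   = Aset G k
  B   = Bset G k
  C   = Cset G k
  V∖A = VminusA G k

  A? : ∀ v → Dec (suc (deg G v) ≡ k)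
  A? v = suc (deg G v) ≟ k
  B? : ∀ v → Dec (k < suc (deg G v))
  B? v = k <? suc (deg G v)
  C? : ∀ v → Dec (suc (deg G v) < k)
  C? v = suc (deg G v) <? k

  ∈A⁻ : ∀ {x} → x ∈ A → suc (deg G x) ≡ k
  ∈A⁻ = ∈-decided⁻ A?
  ∈B⁻ : ∀ {x} → x ∈ B → k < suc (deg G x)
  ∈B⁻ = ∈-decided⁻ B?
  ∈C⁻ : ∀ {x} → x ∈ C → suc (deg G x) < k
  ∈C⁻ = ∈-decided⁻ C?

  abc : ∀ x → x ∈ A ⊎ x ∈ B ⊎ x ∈ C
  abc x with <-cmp (suc (deg G x)) k
  ... | tri< lt _ _ = inj₂ (inj₂ (∈-decided⁺ C? lt))
  ... | tri≈ _ eq _ = inj₁ (∈-decided⁺ A? eq)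
  ... | tri> _ _ gt = inj₂ (inj₁ (∈-decided⁺ B? gt))

  A∉B : ∀ {x} → x ∈ A → x ∉ B
  A∉B x∈A x∈B = <-irrefl (sym (∈A⁻ x∈A)) (∈B⁻ x∈B)

  B∉C : ∀ {x} → x ∈ B → x ∉ C
  B∉C x∈B x∈C = <-asym (∈B⁻ x∈B) (∈C⁻ x∈C)

  V∖A≡B∪C : V∖A ≡ B ∪ C
  V∖A≡B∪C = ⊆-antisym V∖A⊆B∪C B∪C⊆V∖A
    where
    V∖A⊆B∪C : V∖A ⊆ B ∪ C
    V∖A⊆B∪C {x} x∈ with abc x
    ... | inj₁ x∈A = contradiction (∈A⁻ x∈A) (∉-decided⁻ A? x∈)
    ... | inj₂ x∈B∪C = x∈p∪q⁺ x∈B∪C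
    B∪C⊆V∖A : B ∪ C ⊆ V∖A
    B∪C⊆V∖A {x} x∈ = ∉-decided⁺ A? not-A
      where
      not-A : suc (deg G x) ≢ k
      not-A 1+d≡k with x∈p∪q⁻ B C x∈
      ... | inj₁ x∈B = <-irrefl (sym 1+d≡k) (∈B⁻ x∈B)
      ... | inj₂ x∈C = <-irrefl 1+d≡k (∈C⁻ x∈C)

  degree-balance : ∀ x → suc (deg G x) + suc (deg Ḡ x) ≡ k + k̄
  degree-balance x = begin
    suc (deg G x) + suc (deg Ḡ x)  ≡⟨ cong suc (+-suc (deg G x) (deg Ḡ x)) ⟩
    suc (suc (deg G x + deg Ḡ x))  ≡⟨ cong suc (degree-sum co x) ⟩
    suc n                          ≡⟨ k+k̄≡1+n ⟨
    k + k̄                          ∎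
    where open ≡-Reasoning

  A-co-degree : ∀ {x} → x ∈ A → deg Ḡ x < k̄
  A-co-degree {x} x∈A = ≤-reflexive (+-cancelˡ-≡ (suc (deg G x)) _ _
    (trans (degree-balance x) (cong (_+ k̄) (sym (∈A⁻ x∈A)))))

  B-co-degree : ∀ {x} → x ∈ B → suc (deg Ḡ x) < k̄
  B-co-degree {x} x∈B = +-balance-< (sym (degree-balance x)) (∈B⁻ x∈B)

  C-co-degree : ∀ {x} → x ∈ C → k̄ < suc (deg Ḡ x)
  C-co-degree {x} x∈C = +-balance-< (degree-balance x) (∈C⁻ x∈C)

  -- The edge rule in G makes C stable and A anticomplete to C; in Ḡ it makes
  -- B a clique and A complete to B.
  module Rule  = EdgeRule co χG χḠ k+k̄≡1+n
  module Ruleᶜ = EdgeRule (complementary-sym co) χḠ χG (trans (+-comm k̄ k) k+k̄≡1+n)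

  C-stable : IsStable G C
  C-stable u v u∈C v∈C = Rule.edge-rule (<⇒≤ (∈C⁻ u∈C)) (∈C⁻ v∈C)

  A-C-anticomplete : ∀ {a c} → a ∈ A → c ∈ C → adj G a c ≡ false
  A-C-anticomplete a∈A c∈C = Rule.edge-rule (≤-reflexive (∈A⁻ a∈A)) (∈C⁻ c∈C)

  B-clique : IsClique G B
  B-clique u v u∈B v∈B u≢v = non-edge⇒co-edge (complementary-sym co) u≢v
    (Ruleᶜ.edge-rule {u} {v} (<⇒≤ (B-co-degree u∈B)) (B-co-degree v∈B))

  A-B-complete : ∀ {a b} → a ∈ A → b ∈ B → adj G a b ≡ true
  A-B-complete {a} {b} a∈A b∈B = non-edge⇒co-edge (complementary-sym co) (λ { refl → A∉B a∈A b∈B })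
    (Ruleᶜ.edge-rule {a} {b} (A-co-degree a∈A) (B-co-degree b∈B))

  KS-partition : IsKSPartition G V∖A B C
  KS-partition =
    sym V∖A≡B∪C , Empty-unique (λ (x , x∈) → uncurry B∉C (x∈p∩q⁻ B C x∈)) , B-clique , C-stable

  -- NG-1: A ∪ B is a clique, so every b ∈ B (deg b ≥ k) has a neighbour in C,
  -- and the exchange lemma bounds every stable subset of B ∪ C by |C|.
  S-max : IsNG1 G k → IsSMax G V∖A C
  S-max (_ , A-clique) T T⊆V∖A T-stable =
    stable-exchange {X = G} B-clique T-stable in-B∪C
      (λ b∈B → neighbour-outside {X = G} χG A∪B-clique cover (x∈p∪q⁺ (inj₂ b∈B)) (∈B⁻ b∈B))
    where
    in-B∪C : ∀ {x} → x ∈ T → x ∈ B ⊎ x ∈ C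
    in-B∪C x∈T = x∈p∪q⁻ B C (subst (_ ∈_) V∖A≡B∪C (T⊆V∖A x∈T))
    A∪B-clique : IsClique G (A ∪ B)
    A∪B-clique = ∪-clique {X = G} A-clique B-clique A-B-complete
    cover : ∀ w → w ∈ A ∪ B ⊎ w ∈ C
    cover w with abc w
    ... | inj₁ w∈A          = inj₁ (x∈p∪q⁺ (inj₁ w∈A))
    ... | inj₂ (inj₁ w∈B)   = inj₁ (x∈p∪q⁺ (inj₂ w∈B))
    ... | inj₂ (inj₂ w∈C)   = inj₂ w∈C

  -- NG-2: the same argument in Ḡ, where A ∪ C is a clique, C is a clique,
  -- every c ∈ C has degree ≥ k̄, and a clique T of G is stable.
  K-max : IsNG2 G k → IsKMax G V∖A B
  K-max (_ , A-stable) T T⊆V∖A T-clique =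
    stable-exchange {X = Ḡ} (stable⇒co-clique co C-stable) (clique⇒co-stable co T-clique) in-C∪B
      (λ c∈C → neighbour-outside {X = Ḡ} χḠ A∪C-co-clique cover (x∈p∪q⁺ (inj₂ c∈C))
                                 (C-co-degree c∈C))
    where
    in-C∪B : ∀ {x} → x ∈ T → x ∈ C ⊎ x ∈ B
    in-C∪B x∈T = swap (x∈p∪q⁻ B C (subst (_ ∈_) V∖A≡B∪C (T⊆V∖A x∈T)))
    A∪C-co-clique : IsClique Ḡ (A ∪ C)
    A∪C-co-clique = stable⇒co-clique co (∪-stable {X = G} A-stable C-stable A-C-anticomplete)
    cover : ∀ w → w ∈ A ∪ C ⊎ w ∈ B
    cover w with abc w
    ... | inj₁ w∈A          = inj₁ (x∈p∪q⁺ (inj₁ w∈A))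
    ... | inj₂ (inj₁ w∈B)   = inj₂ w∈B
    ... | inj₂ (inj₂ w∈C)   = inj₁ (x∈p∪q⁺ (inj₂ w∈C))

lemma4p2 : ∀ {n} (G : Graph n) (k : ℕ) → IsChromaticNumber G k → IsNG G →
    IsKSPartition G (VminusA G k) (Bset G k) (Cset G k)
    × (IsNG1 G k → IsSMax G (VminusA G k) (Cset G k))
    × (IsNG2 G k → IsKMax G (VminusA G k) (Bset G k))
lemma4p2 G k χG ng = KS-partition , S-max , K-max
  where open NGGraph G k χG ng
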